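{- For every integer $n\ge 3$, the number of permutations of $[n]$ that contain no occurrence of the pattern $123$ and exactly two occurrences of the pattern $132$ equals \[ \binom{n-3}{1}2^{n-4}+\binom{n-3}{2}2^{n-5}. \]
   Context: A permutation of $[n]$ is a word $\pi_1\cdots\pi_n$. An occurrence of $123$ in $\pi$ is a triple of positions $i<j<k$ with $\pi_i<\pi_j<\pi_k$; an occurrence of $132$ is a triple of positions $i<j<k$ with $\pi_i<\pi_k<\pi_j$. -}

module Defs where

open import Data.Nat using (ℕ; zero; suc; _+_; _*_; _^_; _∸_; _≟_)
open import Data.Nat.Combinatorics using (_C_)
open import Data.Fin using (Fin; _<_; _<?_)
open import Data.Fin.Properties using (_≟_)
open import Data.List using (List; []; _∷_; map; concatMap; filter; length; allFin)
open import Data.Vec using (Vec; []; _∷_; lookup; toList)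
open import Data.List.Relation.Unary.Unique.Propositional using (Unique)
import Data.List.Relation.Unary.Unique.DecPropositional as UDec
open import Data.Product using (_×_; _,_)
open import Relation.Nullary using (Dec; yes; no; ¬_)
open import Relation.Nullary.Decidable using (_×-dec_)
open import Relation.Binary.PropositionalEquality using (_≡_)
open import Relation.Unary using (Pred; Decidable)
open import Level using (0ℓ)

Word : ℕ → Set
Word n = Vec (Fin n) n

allVecs : (n m : ℕ) → List (Vec (Fin n) m)
allVecs n zero    = [] ∷ []
allVecs n (suc m) = concatMap (λ a → map (a ∷_) (allVecs n m)) (allFin n)

IsPerm : ∀ {n} → Word n → Set
IsPerm π = Unique (toList π)

isPerm? : ∀ {n} (π : Word n) → Dec (IsPerm π)
isPerm? π = UDec.unique? Data.Fin.Properties._≟_ (toList π)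

perms : (n : ℕ) → List (Word n)
perms n = filter isPerm? (allVecs n n)

triples : (n : ℕ) → List (Fin n × Fin n × Fin n)
triples n = filter (λ { (i , j , k) → (i <? j) ×-dec (j <? k) })
  (concatMap (λ i → concatMap (λ j → map (λ k → (i , j , k)) (allFin n)) (allFin n)) (allFin n))

occ123 : ∀ {n} → Word n → ℕ
occ123 {n} π = length (filter
  (λ { (i , j , k) → (lookup π i <? lookup π j) ×-dec (lookup π j <? lookup π k) })
  (triples n))

occ132 : ∀ {n} → Word n → ℕ
occ132 {n} π = length (filter
  (λ { (i , j , k) → (lookup π i <? lookup π k) ×-dec (lookup π k <? lookup π j) })
  (triples n))

count : (n : ℕ) → ℕ
count n = length (filter
  (λ π → (occ123 π Data.Nat.≟ 0) ×-dec (occ132 π Data.Nat.≟ 2))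
  (perms n))

module Submission where

-- Every permutation of [n + 1] arises in exactly one way by inserting a new minimum 0 into a
-- permutation τ of [n] shifted up by one. The inserted 0 can only play the role of the 1 in a
-- 123 or a 132, and placed in front of the suffix β of τ it creates one 123 for every
-- non-inversion and one 132 for every inversion of β. With no 123 and at most two 132 allowed,
-- β has length at most 2: the two positions at the end are always admissible, and the position
-- in front of the last two letters is admissible exactly when τ ends with a descent, at the cost
-- of one more 132. Counting by N k n the permutations with no 123 and k occurrences of 132, and
-- by Nᵈ k n those among them that end with a descent, this gives for n ≥ 1
--   N k (n + 1) = 2 N k n + Nᵈ (k - 1) n   and   Nᵈ k (n + 1) = N k n + Nᵈ (k - 1) n,
-- which are solved successively for k = 0, 1, 2.

open import Algebra.Properties.CommutativeSemigroup using (interchange)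
open import Data.Bool using (Bool; true; false; _∧_)
open import Data.Bool.Properties using (∧-zeroʳ; ∧-identityʳ; ∧-assoc; ∧-idem)
open import Data.Fin as Fin using (Fin; toℕ)
open import Data.Fin.Properties using (toℕ-injective; toℕ<n; toℕ-fromℕ<)
open import Data.List using (List; []; _∷_; _++_; map; concatMap; filter; length; allFin; tabulate; upTo; tails)
open import Data.List.Membership.Propositional using (_∈_; lose; find)
open import Data.List.Membership.Propositional.Properties
  using (∈-map⁺; ∈-map⁻; ∈-concatMap⁺; ∈-concatMap⁻; ∈-∃++; ∈-filter⁺; ∈-filter⁻; ∈-upTo⁺; ∈-allFin)
open import Data.List.Membership.Propositional.Properties.WithK using (unique∧set⇒bag)
open import Data.List.Properties
  using (map-tabulate; length-filter; length-map; length-upTo; map-++; map-injective; ∷-injectiveˡ; ∷-injectiveʳ)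
open import Data.List.Relation.Binary.BagAndSetEquality using (∼bag⇒↭)
open import Data.List.Relation.Binary.Permutation.Propositional using (_↭_; ↭-sym; ↭⇒↭ₛ)
open import Data.List.Relation.Binary.Permutation.Propositional.Properties using (↭-length; All-resp-↭; shift)
import Data.List.Relation.Binary.Permutation.Setoid.Properties as PermutationSetoid
open import Data.List.Relation.Binary.Subset.Propositional using (_⊆_)
open import Data.List.Relation.Unary.All as All using (All; []; _∷_)
import Data.List.Relation.Unary.All.Properties as All
open import Data.List.Relation.Unary.AllPairs as AllPairs using ([]; _∷_)
import Data.List.Relation.Unary.AllPairs.Properties as AllPairs
open import Data.List.Relation.Unary.Any using (here; there)
open import Data.List.Relation.Unary.Unique.Propositional using (Unique)
import Data.List.Relation.Unary.Unique.Propositional.Properties as Unique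
open import Data.Nat
  using (ℕ; zero; suc; _+_; _*_; _^_; _∸_; _<ᵇ_; _≤_; _<_; _≟_; _<?_; z≤n; s≤s; z<s; s<s; s<s⁻¹)
open import Data.List.Membership.DecPropositional _≟_ using (_∈?_)
open import Data.Nat.Combinatorics using (_C_; nC1≡n; nCk+nC[k+1]≡[n+1]C[k+1])
open import Data.Nat.Properties
  using (≤-refl; <-irrefl; n<1+n; <⇒≱; <-cmp; m≤m+n; m≤n+m; +-mono-≤; +-assoc; +-comm; +-identityʳ;
         1+n≢0; m+n≡0⇒n≡0; suc-injective; *-zeroʳ; *-distribˡ-+; +-commutativeSemigroup; module ≤-Reasoning)
open import Data.Nat.Solver using (module +-*-Solver)
open import Data.Product using (_×_; _,_; proj₁; proj₂; map₁; uncurry; ∃; ∃₂)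
open import Data.Vec as Vec using (Vec; lookup; toList)
open import Data.Vec.Properties using (length-toList)
open import Function using (_∘_; id)
open import Function.Bundles using (_⇔_; mk⇔; Equivalence)
open import Level using (0ℓ)
open import Relation.Binary using (tri<; tri≈; tri>)
open import Relation.Binary.PropositionalEquality
  using (_≡_; _≢_; refl; sym; trans; cong; cong₂; subst; setoid; module ≡-Reasoning)
open import Relation.Nullary using (Dec; does; yes; no; ¬_; contradiction)
open import Relation.Nullary.Decidable using (_×-dec_; dec-true; dec-false)
open import Relation.Unary using (Pred)

open import Defs

open +-*-Solver using (solve; _:+_; _:*_; _:=_; con)

private
  variable
    A B : Set

𝟙 : Bool → ℕ
𝟙 true  = 1
𝟙 false = 0

∑ : (A → ℕ) → List A → ℕ
∑ f []       = 0
∑ f (x ∷ xs) = f x + ∑ f xs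

∑-cong : {f g : A → ℕ} → (∀ x → f x ≡ g x) → ∀ xs → ∑ f xs ≡ ∑ g xs
∑-cong f≗g []       = refl
∑-cong f≗g (x ∷ xs) = cong₂ _+_ (f≗g x) (∑-cong f≗g xs)

∑-cong-∈ : ∀ {f g : A → ℕ} xs → (∀ {x} → x ∈ xs → f x ≡ g x) → ∑ f xs ≡ ∑ g xs
∑-cong-∈ []       f≗g = refl
∑-cong-∈ (x ∷ xs) f≗g = cong₂ _+_ (f≗g (here refl)) (∑-cong-∈ xs (f≗g ∘ there))

∑-zero : ∀ {f : A → ℕ} → (∀ x → f x ≡ 0) → ∀ xs → ∑ f xs ≡ 0
∑-zero f≡0 []       = refl
∑-zero f≡0 (x ∷ xs) = cong₂ _+_ (f≡0 x) (∑-zero f≡0 xs)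

∑-++ : ∀ (f : A → ℕ) xs ys → ∑ f (xs ++ ys) ≡ ∑ f xs + ∑ f ys
∑-++ f []       ys = refl
∑-++ f (x ∷ xs) ys = trans (cong (f x +_) (∑-++ f xs ys)) (sym (+-assoc (f x) _ _))

∑-delete : ∀ {f : A → ℕ} {x} → f x ≡ 0 → ∀ xs ys → ∑ f (xs ++ x ∷ ys) ≡ ∑ f (xs ++ ys)
∑-delete {f = f} fx≡0 []       ys = cong (_+ ∑ f ys) fx≡0
∑-delete {f = f} fx≡0 (y ∷ xs) ys = cong (f y +_) (∑-delete fx≡0 xs ys)

∑-map : (f : B → ℕ) (g : A → B) → ∀ xs → ∑ f (map g xs) ≡ ∑ (f ∘ g) xs
∑-map f g []       = refl
∑-map f g (x ∷ xs) = cong (f (g x) +_) (∑-map f g xs)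

∑-concatMap : (f : B → ℕ) (g : A → List B) → ∀ xs →
              ∑ f (concatMap g xs) ≡ ∑ (∑ f ∘ g) xs
∑-concatMap f g []       = refl
∑-concatMap f g (x ∷ xs) = trans (∑-++ f (g x) _) (cong (∑ f (g x) +_) (∑-concatMap f g xs))

∑-+ : ∀ (f g : A → ℕ) xs → ∑ (λ x → f x + g x) xs ≡ ∑ f xs + ∑ g xs
∑-+ f g []       = refl
∑-+ f g (x ∷ xs) = trans (cong (f x + g x +_) (∑-+ f g xs)) (interchange +-commutativeSemigroup (f x) (g x) (∑ f xs) (∑ g xs))

∑-* : ∀ c (f : A → ℕ) xs → ∑ (λ x → c * f x) xs ≡ c * ∑ f xs
∑-* c f []       = sym (*-zeroʳ c)
∑-* c f (x ∷ xs) = trans (cong (c * f x +_) (∑-* c f xs)) (sym (*-distribˡ-+ c (f x) (∑ f xs)))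

∑-filter : {P : Pred A 0ℓ} (P? : ∀ x → Dec (P x)) (b : A → Bool) → ∀ xs →
           ∑ (𝟙 ∘ b) (filter P? xs) ≡ ∑ (λ x → 𝟙 (does (P? x) ∧ b x)) xs
∑-filter P? b []       = refl
∑-filter P? b (x ∷ xs) with does (P? x)
... | true  = cong (𝟙 (b x) +_) (∑-filter P? b xs)
... | false = ∑-filter P? b xs

length≡∑ : {P : Pred A 0ℓ} (P? : ∀ x → Dec (P x)) → ∀ xs →
           length (filter P? xs) ≡ ∑ (𝟙 ∘ does ∘ P?) xs
length≡∑ P? []       = refl
length≡∑ P? (x ∷ xs) with does (P? x)
... | true  = cong suc (length≡∑ P? xs)
... | false = length≡∑ P? xs

∑ᶠ : ∀ m → (Fin m → ℕ) → ℕ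
∑ᶠ zero    f = 0
∑ᶠ (suc m) f = f Fin.zero + ∑ᶠ m (f ∘ Fin.suc)

∑ᶠ-cong : ∀ m {f g : Fin m → ℕ} → (∀ i → f i ≡ g i) → ∑ᶠ m f ≡ ∑ᶠ m g
∑ᶠ-cong zero    f≗g = refl
∑ᶠ-cong (suc m) f≗g = cong₂ _+_ (f≗g Fin.zero) (∑ᶠ-cong m (f≗g ∘ Fin.suc))

∑ᶠ-zero : ∀ m {f : Fin m → ℕ} → (∀ i → f i ≡ 0) → ∑ᶠ m f ≡ 0
∑ᶠ-zero zero    f≡0 = refl
∑ᶠ-zero (suc m) f≡0 = cong₂ _+_ (f≡0 Fin.zero) (∑ᶠ-zero m (f≡0 ∘ Fin.suc))

∑-allFin : ∀ m (f : Fin m → ℕ) → ∑ f (allFin m) ≡ ∑ᶠ m f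
∑-allFin zero    f = refl
∑-allFin (suc m) f = cong (f Fin.zero +_) (begin
  ∑ f (tabulate Fin.suc)          ≡⟨ cong (∑ f) (sym (map-tabulate id Fin.suc)) ⟩
  ∑ f (map Fin.suc (allFin m))    ≡⟨ ∑-map f Fin.suc (allFin m) ⟩
  ∑ (f ∘ Fin.suc) (allFin m)      ≡⟨ ∑-allFin m (f ∘ Fin.suc) ⟩
  ∑ᶠ m (f ∘ Fin.suc)              ∎)
  where open ≡-Reasoning

-- Occurrences of patterns

pairs : (ℕ → ℕ → Bool) → List ℕ → ℕ
pairs R []       = 0
pairs R (x ∷ xs) = ∑ (𝟙 ∘ R x) xs + pairs R xs

occurrences : (ℕ → ℕ → ℕ → Bool) → List ℕ → ℕ
occurrences r []       = 0
occurrences r (x ∷ xs) = pairs (r x) xs + occurrences r xs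

p123 p132 : ℕ → ℕ → ℕ → Bool
p123 a b c = (a <ᵇ b) ∧ (b <ᵇ c)
p132 a b c = (a <ᵇ c) ∧ (c <ᵇ b)

toℕs : ∀ {a m} → Vec (Fin a) m → List ℕ
toℕs v = map toℕ (toList v)

orderedTriples : ∀ m → (Fin m → Fin m → Fin m → Bool) → ℕ
orderedTriples m R = ∑ᶠ m λ i → ∑ᶠ m λ j → ∑ᶠ m λ k →
  𝟙 (((toℕ i <ᵇ toℕ j) ∧ (toℕ j <ᵇ toℕ k)) ∧ R i j k)

allTriples : ∀ m → List (Fin m × Fin m × Fin m)
allTriples m = concatMap (λ i → concatMap (λ j → map (λ k → (i , j , k)) (allFin m)) (allFin m)) (allFin m)

∑-allTriples : ∀ m (h : Fin m × Fin m × Fin m → ℕ) →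
  ∑ h (allTriples m) ≡ ∑ᶠ m λ i → ∑ᶠ m λ j → ∑ᶠ m λ k → h (i , j , k)
∑-allTriples m h =
  trans (∑-concatMap h _ (allFin m)) (trans (∑-allFin m _) (∑ᶠ-cong m λ i →
  trans (∑-concatMap h _ (allFin m)) (trans (∑-allFin m _) (∑ᶠ-cong m λ j →
  trans (∑-map h _ (allFin m)) (∑-allFin m _)))))

length-filter-triples : ∀ m {P : Pred (Fin m × Fin m × Fin m) 0ℓ} (P? : ∀ t → Dec (P t)) →
  length (filter P? (triples m)) ≡ orderedTriples m (λ i j k → does (P? (i , j , k)))
length-filter-triples m P? =
  trans (length≡∑ P? (triples m)) (trans (∑-filter _ (does ∘ P?) (allTriples m)) (∑-allTriples m _))

∑ᶠ-lookup : ∀ {a m} (v : Vec (Fin a) m) (g : ℕ → ℕ) →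
  ∑ᶠ m (λ k → g (toℕ (lookup v k))) ≡ ∑ g (toℕs v)
∑ᶠ-lookup Vec.[]       g = refl
∑ᶠ-lookup (x Vec.∷ v) g = cong (g (toℕ x) +_) (∑ᶠ-lookup v g)

orderedPairs-lookup : ∀ {a m} (R : ℕ → ℕ → Bool) (v : Vec (Fin a) m) →
  (∑ᶠ m λ j → ∑ᶠ m λ k → 𝟙 ((toℕ j <ᵇ toℕ k) ∧ R (toℕ (lookup v j)) (toℕ (lookup v k))))
    ≡ pairs R (toℕs v)
orderedPairs-lookup R Vec.[]       = refl
orderedPairs-lookup R (x Vec.∷ v) =
  cong₂ _+_ (∑ᶠ-lookup v (𝟙 ∘ R (toℕ x))) (orderedPairs-lookup R v)

orderedTriples-lookup : ∀ {a m} (r : ℕ → ℕ → ℕ → Bool) (v : Vec (Fin a) m) →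
  orderedTriples m (λ i j k → r (toℕ (lookup v i)) (toℕ (lookup v j)) (toℕ (lookup v k)))
    ≡ occurrences r (toℕs v)
orderedTriples-lookup r Vec.[] = refl
orderedTriples-lookup {m = suc m} r (x Vec.∷ v) = cong₂ _+_
  (cong₂ _+_ (∑ᶠ-zero (suc m) λ _ → refl) (orderedPairs-lookup (r (toℕ x)) v))
  (trans (∑ᶠ-cong m λ i → cong₂ _+_ (∑ᶠ-zero (suc m) λ _ → refl)
                                    (∑ᶠ-cong m λ j → cong₂ _+_ (lastIndexZero i j) refl))
         (orderedTriples-lookup r v))
  where
  lastIndexZero : ∀ i j →
    𝟙 (((toℕ i <ᵇ toℕ j) ∧ false) ∧ r (toℕ (lookup v i)) (toℕ (lookup v j)) (toℕ x)) ≡ 0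
  lastIndexZero i j rewrite ∧-zeroʳ (toℕ i <ᵇ toℕ j) = refl

occ123≡occurrences : ∀ {n} (π : Word n) → occ123 π ≡ occurrences p123 (toℕs π)
occ123≡occurrences {n} π = trans (length-filter-triples n _) (orderedTriples-lookup p123 π)

occ132≡occurrences : ∀ {n} (π : Word n) → occ132 π ≡ occurrences p132 (toℕs π)
occ132≡occurrences {n} π = trans (length-filter-triples n _) (orderedTriples-lookup p132 π)

-- Permutations of [n] as insertions of a new minimum

unique-⊆⇒length≤ : ∀ {xs ys : List ℕ} → Unique xs → Unique ys → xs ⊆ ys → length xs ≤ length ys
unique-⊆⇒length≤ {xs} {ys} xs! ys! xs⊆ys = begin
  length xs                    ≡⟨ ↭-length (∼bag⇒↭ (unique∧set⇒bag xs! (Unique.filter⁺ (_∈? xs) ys!) same)) ⟩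
  length (filter (_∈? xs) ys)  ≤⟨ length-filter (_∈? xs) ys ⟩
  length ys                    ∎
  where
  open ≤-Reasoning
  same : ∀ {x} → x ∈ xs ⇔ x ∈ filter (_∈? xs) ys
  same = mk⇔ (λ x∈xs → ∈-filter⁺ (_∈? xs) (xs⊆ys x∈xs) x∈xs) (proj₂ ∘ ∈-filter⁻ (_∈? xs) {xs = ys})

concatMap-unique : ∀ {xs : List A} {f : A → List B} → Unique xs → (∀ x → Unique (f x)) →
  (∀ {x x′ y} → y ∈ f x → y ∈ f x′ → x ≡ x′) → Unique (concatMap f xs)
concatMap-unique {xs = xs} xs! f! fibres = Unique.concat⁺
  (All.map⁺ (All.universal f! xs))
  (AllPairs.map⁺ (AllPairs.map (λ x≢x′ {_} (y∈fx , y∈fx′) → x≢x′ (fibres y∈fx y∈fx′)) xs!))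

splits : List A → List (List A × List A)
splits []       = ([] , []) ∷ []
splits (x ∷ xs) = ([] , x ∷ xs) ∷ map (map₁ (x ∷_)) (splits xs)

∈-splits⁻ : ∀ {xs α β : List A} → (α , β) ∈ splits xs → α ++ β ≡ xs
∈-splits⁻ {xs = []}     (here refl) = refl
∈-splits⁻ {xs = x ∷ xs} (here refl) = refl
∈-splits⁻ {xs = x ∷ xs} (there αβ∈) with ∈-map⁻ (map₁ (x ∷_)) αβ∈
... | _ , αβ∈′ , refl = cong (x ∷_) (∈-splits⁻ αβ∈′)

∈-splits⁺ : ∀ (α β : List A) → (α , β) ∈ splits (α ++ β)
∈-splits⁺ []      []      = here refl
∈-splits⁺ []      (_ ∷ _) = here refl
∈-splits⁺ (a ∷ α) β       = there (∈-map⁺ (map₁ (a ∷_)) (∈-splits⁺ α β))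

splits-unique : ∀ (xs : List A) → Unique (splits xs)
splits-unique []       = [] ∷ []
splits-unique (x ∷ xs) =
  All.map⁺ (All.universal (λ _ ()) (splits xs))
  ∷ Unique.map⁺ (λ { {_ , _} {_ , _} refl → refl }) (splits-unique xs)

∑-splits : ∀ (g : List A → ℕ) xs → ∑ (g ∘ proj₂) (splits xs) ≡ ∑ g (tails xs)
∑-splits g []       = refl
∑-splits g (x ∷ xs) = cong (g (x ∷ xs) +_) (trans (∑-map (g ∘ proj₂) (map₁ (x ∷_)) (splits xs)) (∑-splits g xs))

insertZero : List ℕ → List ℕ → List ℕ
insertZero α β = map suc α ++ 0 ∷ map suc β

insertZero-injective : ∀ α {α′ β β′} → insertZero α β ≡ insertZero α′ β′ → (α , β) ≡ (α′ , β′)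
insertZero-injective []      {[]}     eq = cong ([] ,_) (map-injective suc-injective (∷-injectiveʳ eq))
insertZero-injective (a ∷ α) {a′ ∷ α′} eq
  with refl ← suc-injective (∷-injectiveˡ eq) | refl ← insertZero-injective α (∷-injectiveʳ eq) = refl

insertZero-↭ : ∀ α β → insertZero α β ↭ 0 ∷ map suc (α ++ β)
insertZero-↭ α β = subst (λ γ → insertZero α β ↭ 0 ∷ γ) (sym (map-++ suc α β)) (shift 0 (map suc α) (map suc β))

insertions : List ℕ → List (List ℕ)
insertions τ = map (uncurry insertZero) (splits τ)

permutations : ℕ → List (List ℕ)
permutations zero    = [] ∷ []
permutations (suc n) = concatMap insertions (permutations n)

IsPermℕ : ℕ → List ℕ → Set
IsPermℕ n xs = Unique xs × length xs ≡ n × All (_< n) xs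

IsPermℕ-resp-↭ : ∀ {n xs ys} → xs ↭ ys → IsPermℕ n xs → IsPermℕ n ys
IsPermℕ-resp-↭ xs↭ys (xs! , ∣xs∣≡n , xs<n) =
  PermutationSetoid.Unique-resp-↭ (setoid ℕ) (↭⇒↭ₛ xs↭ys) xs! ,
  trans (sym (↭-length xs↭ys)) ∣xs∣≡n ,
  All-resp-↭ xs↭ys xs<n

IsPermℕ-shift⁺ : ∀ {n τ} → IsPermℕ n τ → IsPermℕ (suc n) (0 ∷ map suc τ)
IsPermℕ-shift⁺ {τ = τ} (τ! , ∣τ∣≡n , τ<n) =
  All.map⁺ (All.universal (λ _ ()) τ) ∷ Unique.map⁺ suc-injective τ! ,
  cong suc (trans (length-map suc τ) ∣τ∣≡n) ,
  z<s ∷ All.map⁺ (All.map s<s τ<n)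

IsPermℕ-shift⁻ : ∀ {n τ} → IsPermℕ (suc n) (0 ∷ map suc τ) → IsPermℕ n τ
IsPermℕ-shift⁻ {τ = τ} (_ ∷ τ! , ∣τ∣≡n , _ ∷ τ<n) =
  Unique.map⁻ τ! ,
  trans (sym (length-map suc τ)) (suc-injective ∣τ∣≡n) ,
  All.map s<s⁻¹ (All.map⁻ τ<n)

zero-∈-perm : ∀ {n xs} → IsPermℕ (suc n) xs → 0 ∈ xs
zero-∈-perm {n} {xs} (xs! , ∣xs∣≡1+n , xs<1+n) with 0 ∈? xs
... | yes 0∈xs = 0∈xs
... | no  0∉xs = contradiction (begin-strict
    n                          <⟨ n<1+n n ⟩
    suc n                      ≡⟨ sym ∣xs∣≡1+n ⟩
    length xs                  ≤⟨ unique-⊆⇒length≤ xs! (Unique.map⁺ suc-injective (Unique.upTo⁺ n)) xs⊆ ⟩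
    length (map suc (upTo n))  ≡⟨ length-map suc (upTo n) ⟩
    length (upTo n)            ≡⟨ length-upTo n ⟩
    n                          ∎) (<-irrefl refl)
  where
  open ≤-Reasoning
  xs⊆ : xs ⊆ map suc (upTo n)
  xs⊆ {zero}  0∈xs = contradiction 0∈xs 0∉xs
  xs⊆ {suc x} x∈xs = ∈-map⁺ suc (∈-upTo⁺ (s<s⁻¹ (All.lookup xs<1+n x∈xs)))

∈-insertions⁻ : ∀ {τ ys} → ys ∈ insertions τ → ∃₂ λ α β → α ++ β ≡ τ × ys ≡ insertZero α β
∈-insertions⁻ ys∈ with (α , β) , αβ∈ , refl ← ∈-map⁻ (uncurry insertZero) ys∈ = α , β , ∈-splits⁻ αβ∈ , refl

insertions-unique : ∀ τ → Unique (insertions τ)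
insertions-unique τ = Unique.map⁺ (λ { {α , _} {_ , _} eq → insertZero-injective α eq }) (splits-unique τ)

permutations-unique : ∀ n → Unique (permutations n)
permutations-unique zero    = [] ∷ []
permutations-unique (suc n) = concatMap-unique (permutations-unique n) insertions-unique fibres
  where
  fibres : ∀ {τ τ′ ys} → ys ∈ insertions τ → ys ∈ insertions τ′ → τ ≡ τ′
  fibres ys∈ ys∈′
    with α , _ , refl , refl ← ∈-insertions⁻ ys∈ | _ , _ , refl , eq ← ∈-insertions⁻ ys∈′
    with refl ← insertZero-injective α eq = refl

∈-permutations⁻ : ∀ n {xs} → xs ∈ permutations n → IsPermℕ n xs
∈-permutations⁻ zero    (here refl) = [] , refl , []
∈-permutations⁻ (suc n) xs∈
  with τ , τ∈ , xs∈′ ← find (∈-concatMap⁻ insertions xs∈)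
  with α , β , refl , refl ← ∈-insertions⁻ xs∈′ =
  IsPermℕ-resp-↭ (↭-sym (insertZero-↭ α β)) (IsPermℕ-shift⁺ (∈-permutations⁻ n τ∈))

positive⇒shifted : ∀ {xs} → All (0 ≢_) xs → ∃ λ ys → xs ≡ map suc ys
positive⇒shifted {[]}         []        = [] , refl
positive⇒shifted {zero ∷ xs}  (0≢0 ∷ _) = contradiction refl 0≢0
positive⇒shifted {suc x ∷ xs} (_ ∷ xs⁺) with ys , refl ← positive⇒shifted xs⁺ = x ∷ ys , refl

∈-permutations⁺ : ∀ n {xs} → IsPermℕ n xs → xs ∈ permutations n
∈-permutations⁺ zero    {[]}    _           = here refl
∈-permutations⁺ zero    {_ ∷ _} (_ , () , _)
∈-permutations⁺ (suc n) xs-perm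
  with α′ , β′ , refl ← ∈-∃++ (zero-∈-perm xs-perm)
  with (0∉ ∷ _) , _ ← IsPermℕ-resp-↭ (shift 0 α′ β′) xs-perm
  with α , refl ← positive⇒shifted (proj₁ (All.++⁻ α′ 0∉))
     | β , refl ← positive⇒shifted (proj₂ (All.++⁻ α′ 0∉)) =
  ∈-concatMap⁺ insertions (lose (∈-permutations⁺ n (IsPermℕ-shift⁻ (IsPermℕ-resp-↭ (insertZero-↭ α β) xs-perm)))
                     (∈-map⁺ (uncurry insertZero) (∈-splits⁺ α β)))

IsPermℕ-nonempty : ∀ {n τ} → IsPermℕ (suc n) τ → τ ≢ []
IsPermℕ-nonempty (_ , () , _) refl

toℕs-injective : ∀ {a m} {v w : Vec (Fin a) m} → toℕs v ≡ toℕs w → v ≡ w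
toℕs-injective {v = Vec.[]}    {Vec.[]}    _  = refl
toℕs-injective {v = x Vec.∷ v} {y Vec.∷ w} eq =
  cong₂ Vec._∷_ (toℕ-injective (∷-injectiveˡ eq)) (toℕs-injective (∷-injectiveʳ eq))

toℕs-surjective : ∀ {a} m {xs} → length xs ≡ m → All (_< a) xs → ∃ λ (v : Vec (Fin a) m) → toℕs v ≡ xs
toℕs-surjective zero    {[]}     _  []            = Vec.[] , refl
toℕs-surjective (suc m) {x ∷ xs} eq (x<a ∷ xs<a)
  with v , refl ← toℕs-surjective m (suc-injective eq) xs<a =
  Fin.fromℕ< x<a Vec.∷ v , cong (_∷ toℕs v) (toℕ-fromℕ< x<a)

toℕs-IsPermℕ : ∀ {n} (π : Word n) → IsPerm π → IsPermℕ n (toℕs π)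
toℕs-IsPermℕ π π! =
  Unique.map⁺ toℕ-injective π! ,
  trans (length-map toℕ (toList π)) (length-toList π) ,
  All.map⁺ (All.universal toℕ<n (toList π))

∈-allVecs : ∀ {n m} (v : Vec (Fin n) m) → v ∈ allVecs n m
∈-allVecs Vec.[]      = here refl
∈-allVecs (a Vec.∷ v) = ∈-concatMap⁺ _ (lose (∈-allFin a) (∈-map⁺ (a Vec.∷_) (∈-allVecs v)))

allVecs-unique : ∀ n m → Unique (allVecs n m)
allVecs-unique n zero    = [] ∷ []
allVecs-unique n (suc m) =
  concatMap-unique (Unique.allFin⁺ n) (λ _ → Unique.map⁺ (λ { refl → refl }) (allVecs-unique n m)) fibres
  where
  fibres : ∀ {a a′ v} → v ∈ map (a Vec.∷_) (allVecs n m) → v ∈ map (a′ Vec.∷_) (allVecs n m) → a ≡ a′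
  fibres v∈ v∈′ with _ , _ , refl ← ∈-map⁻ _ v∈ | _ , _ , refl ← ∈-map⁻ _ v∈′ = refl

target? : ∀ k t o → Dec (t ≡ 0 × o ≡ k)
target? k t o = (t ≟ 0) ×-dec (o ≟ k)

target : ℕ → ℕ → ℕ → Bool
target k t o = does (target? k t o)

inTarget? : ∀ k xs → Dec (occurrences p123 xs ≡ 0 × occurrences p132 xs ≡ k)
inTarget? k xs = target? k (occurrences p123 xs) (occurrences p132 xs)

inTarget : ℕ → List ℕ → Bool
inTarget k xs = does (inTarget? k xs)

N : ℕ → ℕ → ℕ
N k n = ∑ (𝟙 ∘ inTarget k) (permutations n)

count≡N : ∀ n → count n ≡ N 2 n
count≡N n = begin
  count n                                        ≡⟨ sym (length-map toℕs targetWords) ⟩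
  length (map toℕs targetWords)                  ≡⟨ ↭-length (∼bag⇒↭ (unique∧set⇒bag words! lists! same)) ⟩
  length (filter (inTarget? 2) (permutations n))  ≡⟨ length≡∑ (inTarget? 2) (permutations n) ⟩
  N 2 n                                          ∎
  where
  open ≡-Reasoning
  Q? = λ (π : Word n) → (occ123 π ≟ 0) ×-dec (occ132 π ≟ 2)
  targetWords = filter Q? (perms n)

  words! : Unique (map toℕs targetWords)
  words! = Unique.map⁺ toℕs-injective (Unique.filter⁺ Q? (Unique.filter⁺ isPerm? (allVecs-unique n n)))

  lists! : Unique (filter (inTarget? 2) (permutations n))
  lists! = Unique.filter⁺ (inTarget? 2) (permutations-unique n)

  transfer : ∀ (π : Word n) → (occ123 π ≡ 0 × occ132 π ≡ 2) ⇔ (occurrences p123 (toℕs π) ≡ 0 × occurrences p132 (toℕs π) ≡ 2)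
  transfer π rewrite occ123≡occurrences π | occ132≡occurrences π = mk⇔ id id

  to : ∀ {xs} → xs ∈ map toℕs targetWords → xs ∈ filter (inTarget? 2) (permutations n)
  to xs∈ with π , π∈ , refl ← ∈-map⁻ toℕs xs∈ with π∈perms , Qπ ← ∈-filter⁻ Q? {xs = perms n} π∈ =
    ∈-filter⁺ (inTarget? 2) (∈-permutations⁺ n (toℕs-IsPermℕ π (proj₂ (∈-filter⁻ isPerm? {xs = allVecs n n} π∈perms))))
      (Equivalence.to (transfer π) Qπ)

  from : ∀ {xs} → xs ∈ filter (inTarget? 2) (permutations n) → xs ∈ map toℕs targetWords
  from xs∈ with xs∈perms , xs-target ← ∈-filter⁻ (inTarget? 2) {xs = permutations n} xs∈
           with xs! , ∣xs∣≡n , xs<n ← ∈-permutations⁻ n xs∈perms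
           with π , refl ← toℕs-surjective n ∣xs∣≡n xs<n =
    ∈-map⁺ toℕs (∈-filter⁺ Q? (∈-filter⁺ isPerm? (∈-allVecs π) (Unique.map⁻ xs!))
      (Equivalence.from (transfer π) xs-target))

  same : ∀ {xs} → xs ∈ map toℕs targetWords ⇔ xs ∈ filter (inTarget? 2) (permutations n)
  same = mk⇔ to from

-- Occurrences created by the inserted minimum

record StartsWithMinimum (r : ℕ → ℕ → ℕ → Bool) : Set where
  field
    shift-invariant : ∀ a b c → r (suc a) (suc b) (suc c) ≡ r a b c
    zero-not-second : ∀ a c → r (suc a) 0 c ≡ false
    zero-not-third  : ∀ a b → r (suc a) b 0 ≡ false

p123-startsWithMinimum : StartsWithMinimum p123
p123-startsWithMinimum = record
  { shift-invariant = λ _ _ _ → refl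
  ; zero-not-second = λ _ _ → refl
  ; zero-not-third  = λ a b → ∧-zeroʳ (suc a <ᵇ b)
  }

p132-startsWithMinimum : StartsWithMinimum p132
p132-startsWithMinimum = record
  { shift-invariant = λ _ _ _ → refl
  ; zero-not-second = λ a c → ∧-zeroʳ (suc a <ᵇ c)
  ; zero-not-third  = λ _ _ → refl
  }

pairs-shift : ∀ {R R′ : ℕ → ℕ → Bool} → (∀ b c → R′ (suc b) (suc c) ≡ R b c) →
  ∀ xs → pairs R′ (map suc xs) ≡ pairs R xs
pairs-shift R′≡R [] = refl
pairs-shift {R′ = R′} R′≡R (x ∷ xs) = cong₂ _+_
  (trans (∑-map (𝟙 ∘ R′ (suc x)) suc xs) (∑-cong (cong 𝟙 ∘ R′≡R x) xs))
  (pairs-shift R′≡R xs)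

pairs-delete-zero : ∀ {R : ℕ → ℕ → Bool} → (∀ c → R 0 c ≡ false) → (∀ b → R b 0 ≡ false) →
  ∀ xs ys → pairs R (xs ++ 0 ∷ ys) ≡ pairs R (xs ++ ys)
pairs-delete-zero {R} R0c Rb0 []       ys = cong (_+ pairs R ys) (∑-zero (cong 𝟙 ∘ R0c) ys)
pairs-delete-zero {R} R0c Rb0 (x ∷ xs) ys =
  cong₂ _+_ (∑-delete (cong 𝟙 (Rb0 x)) xs ys) (pairs-delete-zero R0c Rb0 xs ys)

module _ {r : ℕ → ℕ → ℕ → Bool} (r-min : StartsWithMinimum r) where
  open StartsWithMinimum r-min

  occurrences-shift : ∀ xs → occurrences r (map suc xs) ≡ occurrences r xs
  occurrences-shift []       = refl
  occurrences-shift (x ∷ xs) = cong₂ _+_ (pairs-shift (shift-invariant x) xs) (occurrences-shift xs)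

  occurrences-insertZero : ∀ α β →
    occurrences r (insertZero α β) ≡ occurrences r (α ++ β) + pairs (λ b c → r 0 (suc b) (suc c)) β
  occurrences-insertZero [] β = trans (cong₂ _+_ (pairs-shift (λ _ _ → refl) β) (occurrences-shift β))
                                     (+-comm _ (occurrences r β))
  occurrences-insertZero (a ∷ α) β = begin
    pairs (r (suc a)) (map suc α ++ 0 ∷ map suc β) + occurrences r (insertZero α β)
      ≡⟨ cong₂ _+_ newPairs (occurrences-insertZero α β) ⟩
    pairs (r a) (α ++ β) + (occurrences r (α ++ β) + pairs (λ b c → r 0 (suc b) (suc c)) β)
      ≡⟨ +-assoc (pairs (r a) (α ++ β)) _ _ ⟨
    occurrences r (a ∷ α ++ β) + pairs (λ b c → r 0 (suc b) (suc c)) β  ∎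
    where
    open ≡-Reasoning
    newPairs : pairs (r (suc a)) (map suc α ++ 0 ∷ map suc β) ≡ pairs (r a) (α ++ β)
    newPairs = begin
      pairs (r (suc a)) (map suc α ++ 0 ∷ map suc β)  ≡⟨ pairs-delete-zero (zero-not-second a) (zero-not-third a) (map suc α) _ ⟩
      pairs (r (suc a)) (map suc α ++ map suc β)      ≡⟨ cong (pairs (r (suc a))) (map-++ suc α β) ⟨
      pairs (r (suc a)) (map suc (α ++ β))            ≡⟨ pairs-shift (shift-invariant a) (α ++ β) ⟩
      pairs (r a) (α ++ β)                            ∎

noninversions inversions : List ℕ → ℕ
noninversions = pairs _<ᵇ_
inversions    = pairs λ b c → c <ᵇ b

<ᵇ-true : ∀ {a b} → a < b → (a <ᵇ b) ≡ true
<ᵇ-true {a} {b} = dec-true (a <? b)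

<ᵇ-false : ∀ {a b} → ¬ a < b → (a <ᵇ b) ≡ false
<ᵇ-false {a} {b} = dec-false (a <? b)

∑-comparisons : ∀ {x ys} → All (x ≢_) ys →
  ∑ (λ y → 𝟙 (x <ᵇ y)) ys + ∑ (λ y → 𝟙 (y <ᵇ x)) ys ≡ length ys
∑-comparisons [] = refl
∑-comparisons {x} {y ∷ ys} (x≢y ∷ x∉ys) = begin
  (𝟙 (x <ᵇ y) + ∑ (λ z → 𝟙 (x <ᵇ z)) ys) + (𝟙 (y <ᵇ x) + ∑ (λ z → 𝟙 (z <ᵇ x)) ys)
    ≡⟨ interchange +-commutativeSemigroup (𝟙 (x <ᵇ y)) _ (𝟙 (y <ᵇ x)) _ ⟩
  (𝟙 (x <ᵇ y) + 𝟙 (y <ᵇ x)) + (∑ (λ z → 𝟙 (x <ᵇ z)) ys + ∑ (λ z → 𝟙 (z <ᵇ x)) ys)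
    ≡⟨ cong₂ _+_ exactlyOne (∑-comparisons x∉ys) ⟩
  suc (length ys)  ∎
  where
  open ≡-Reasoning
  exactlyOne : 𝟙 (x <ᵇ y) + 𝟙 (y <ᵇ x) ≡ 1
  exactlyOne with <-cmp x y
  ... | tri< x<y _ y≮x rewrite <ᵇ-true x<y | <ᵇ-false y≮x = refl
  ... | tri≈ _ x≡y _   = contradiction x≡y x≢y
  ... | tri> x≮y _ y<x rewrite <ᵇ-false x≮y | <ᵇ-true y<x = refl

noninversions+inversions-∷ : ∀ {x xs} → Unique (x ∷ xs) →
  noninversions (x ∷ xs) + inversions (x ∷ xs) ≡ length xs + (noninversions xs + inversions xs)
noninversions+inversions-∷ {x} {xs} (x∉xs ∷ _) = trans
  (interchange +-commutativeSemigroup (∑ (λ y → 𝟙 (x <ᵇ y)) xs) (noninversions xs) (∑ (λ y → 𝟙 (y <ᵇ x)) xs) (inversions xs))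
  (cong (_+ (noninversions xs + inversions xs)) (∑-comparisons x∉xs))

3≤noninversions+inversions : ∀ {a b c r} → Unique (a ∷ b ∷ c ∷ r) →
  3 ≤ noninversions (a ∷ b ∷ c ∷ r) + inversions (a ∷ b ∷ c ∷ r)
3≤noninversions+inversions {a} {b} {c} {r} abcr!@(_ ∷ bcr!) = begin
  2 + 1
    ≤⟨ +-mono-≤ (m≤m+n 2 (length r)) (m≤m+n 1 (length r + (noninversions (c ∷ r) + inversions (c ∷ r)))) ⟩
  length (b ∷ c ∷ r) + (length (c ∷ r) + (noninversions (c ∷ r) + inversions (c ∷ r)))
    ≡⟨ cong (length (b ∷ c ∷ r) +_) (noninversions+inversions-∷ bcr!) ⟨
  length (b ∷ c ∷ r) + (noninversions (b ∷ c ∷ r) + inversions (b ∷ c ∷ r))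
    ≡⟨ noninversions+inversions-∷ abcr! ⟨
  noninversions (a ∷ b ∷ c ∷ r) + inversions (a ∷ b ∷ c ∷ r)  ∎
  where open ≤-Reasoning

-- t and o are the numbers of 123s and 132s of τ, and 0 is inserted in front of the suffix β of τ.
targetAfter : ℕ → ℕ → ℕ → List ℕ → Bool
targetAfter k t o β = target k (t + noninversions β) (o + inversions β)

inTarget-insertZero : ∀ k α β →
  inTarget k (insertZero α β) ≡ targetAfter k (occurrences p123 (α ++ β)) (occurrences p132 (α ++ β)) β
inTarget-insertZero k α β = cong₂ (target k)
  (occurrences-insertZero p123-startsWithMinimum α β) (occurrences-insertZero p132-startsWithMinimum α β)

target-positive : ∀ k t o {m} → target k (t + suc m) o ≡ false
target-positive k t o = dec-false (target? k (t + _) o) λ (t+1+m≡0 , _) → 1+n≢0 (m+n≡0⇒n≡0 t t+1+m≡0)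

targetAfter-long : ∀ {k} t o → k ≤ 2 → ∀ {a b c r} → Unique (a ∷ b ∷ c ∷ r) →
  targetAfter k t o (a ∷ b ∷ c ∷ r) ≡ false
targetAfter-long {k} t o k≤2 {a} {b} {c} {r} abcr! = dec-false (target? k _ _) λ (t+n≡0 , o+i≡k) →
  <⇒≱ (s≤s k≤2) (begin
    3                               ≤⟨ 3≤noninversions+inversions abcr! ⟩
    noninversions s + inversions s  ≡⟨ cong (_+ inversions s) (m+n≡0⇒n≡0 t t+n≡0) ⟩
    inversions s                    ≤⟨ m≤n+m (inversions s) o ⟩
    o + inversions s                ≡⟨ o+i≡k ⟩
    k                               ∎)
  where
  open ≤-Reasoning
  s = a ∷ b ∷ c ∷ r

endsWithDescent : List ℕ → Bool
endsWithDescent (a ∷ b ∷ [])    = b <ᵇ a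
endsWithDescent (_ ∷ b ∷ c ∷ r) = endsWithDescent (b ∷ c ∷ r)
endsWithDescent _               = false

targetAfter-pair : ∀ k t o {a b} → a ≢ b →
  targetAfter k t o (a ∷ b ∷ []) ≡ target k t (suc o) ∧ endsWithDescent (a ∷ b ∷ [])
targetAfter-pair k t o {a} {b} a≢b with <-cmp a b
... | tri< a<b _ b≮a rewrite <ᵇ-true a<b | <ᵇ-false b≮a =
  trans (target-positive k t (o + 0)) (sym (∧-zeroʳ _))
... | tri≈ _ a≡b _   = contradiction a≡b a≢b
... | tri> a≮b _ b<a rewrite <ᵇ-false a≮b | <ᵇ-true b<a | +-identityʳ t | +-comm o 1 =
  sym (∧-identityʳ _)

endsWithDescent-shift : ∀ xs → endsWithDescent (map suc xs) ≡ endsWithDescent xs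
endsWithDescent-shift []              = refl
endsWithDescent-shift (_ ∷ [])        = refl
endsWithDescent-shift (_ ∷ _ ∷ [])    = refl
endsWithDescent-shift (_ ∷ b ∷ c ∷ r) = endsWithDescent-shift (b ∷ c ∷ r)

-- The value of endsWithDescent once 0 is inserted in front of the suffix β of a nonempty list;
-- for β = [] the list then ends with a descent to 0.
descentAfterZero : List ℕ → Bool
descentAfterZero []            = true
descentAfterZero (_ ∷ [])      = false
descentAfterZero β@(_ ∷ _ ∷ _) = endsWithDescent β

endsWithDescent-insertZero : ∀ α β → α ++ β ≢ [] →
  endsWithDescent (insertZero α β) ≡ descentAfterZero β
endsWithDescent-insertZero []                  []            []≢[] = contradiction refl []≢[]
endsWithDescent-insertZero []                  (_ ∷ [])      _     = refl
endsWithDescent-insertZero []                  β@(_ ∷ _ ∷ _) _     = endsWithDescent-shift β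
endsWithDescent-insertZero (_ ∷ [])            []            _     = refl
endsWithDescent-insertZero (_ ∷ [])            β@(_ ∷ _)     _     = endsWithDescent-insertZero [] β λ ()
endsWithDescent-insertZero (_ ∷ α@(_ ∷ []))    β             _     = endsWithDescent-insertZero α β λ ()
endsWithDescent-insertZero (_ ∷ α@(_ ∷ _ ∷ _)) β             _     = endsWithDescent-insertZero α β λ ()

module _ {k} (k≤2 : k ≤ 2) (t o : ℕ) where

  ∑-tails-targetAfter : ∀ {x xs} → Unique (x ∷ xs) →
    ∑ (𝟙 ∘ targetAfter k t o) (tails (x ∷ xs))
      ≡ 𝟙 (target k t (suc o) ∧ endsWithDescent (x ∷ xs)) + 2 * 𝟙 (target k t o)
  ∑-tails-targetAfter {xs = []} _
    rewrite +-identityʳ t | +-identityʳ o | ∧-zeroʳ (target k t (suc o)) = refl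
  ∑-tails-targetAfter {xs = _ ∷ []} ((x≢y ∷ []) ∷ _)
    rewrite targetAfter-pair k t o x≢y | +-identityʳ t | +-identityʳ o = refl
  ∑-tails-targetAfter {xs = _ ∷ _ ∷ _} xs!@(_ ∷ tail!)
    rewrite targetAfter-long t o k≤2 xs! = ∑-tails-targetAfter tail!

  ∑-tails-targetAfter-descent : ∀ {x xs} → Unique (x ∷ xs) →
    ∑ (λ β → 𝟙 (targetAfter k t o β ∧ descentAfterZero β)) (tails (x ∷ xs))
      ≡ 𝟙 (target k t (suc o) ∧ endsWithDescent (x ∷ xs)) + 𝟙 (target k t o)
  ∑-tails-targetAfter-descent {xs = []} _
    rewrite +-identityʳ t | +-identityʳ o | ∧-zeroʳ (target k t (suc o))
          | ∧-zeroʳ (target k t o) | ∧-identityʳ (target k t o) | +-identityʳ (𝟙 (target k t o)) = refl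
  ∑-tails-targetAfter-descent {x} {y ∷ []} ((x≢y ∷ []) ∷ _)
    rewrite targetAfter-pair k t o x≢y | +-identityʳ t | +-identityʳ o
          | ∧-assoc (target k t (suc o)) (y <ᵇ x) (y <ᵇ x) | ∧-idem (y <ᵇ x)
          | ∧-zeroʳ (target k t o) | ∧-identityʳ (target k t o) | +-identityʳ (𝟙 (target k t o)) = refl
  ∑-tails-targetAfter-descent {xs = _ ∷ _ ∷ _} xs!@(_ ∷ tail!)
    rewrite targetAfter-long t o k≤2 xs! = ∑-tails-targetAfter-descent tail!

inTarget-insertion : ∀ k {τ α β} → (α , β) ∈ splits τ →
  inTarget k (insertZero α β) ≡ targetAfter k (occurrences p123 τ) (occurrences p132 τ) β
inTarget-insertion k {α = α} {β} αβ∈ = trans (inTarget-insertZero k α β)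
  (cong (λ σ → targetAfter k (occurrences p123 σ) (occurrences p132 σ) β) (∈-splits⁻ αβ∈))

oneShortDescent : ℕ → List ℕ → Bool
oneShortDescent k τ = target k (occurrences p123 τ) (suc (occurrences p132 τ)) ∧ endsWithDescent τ

module _ {k} (k≤2 : k ≤ 2) where

  ∑-insertions-inTarget : ∀ {τ} → Unique τ → τ ≢ [] →
    ∑ (𝟙 ∘ inTarget k) (insertions τ)
      ≡ 𝟙 (oneShortDescent k τ) + 2 * 𝟙 (inTarget k τ)
  ∑-insertions-inTarget {[]}    _  []≢[] = contradiction refl []≢[]
  ∑-insertions-inTarget {τ@(_ ∷ _)} τ! _ = begin
    ∑ (𝟙 ∘ inTarget k) (insertions τ)                   ≡⟨ ∑-map _ (uncurry insertZero) (splits τ) ⟩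
    ∑ (𝟙 ∘ inTarget k ∘ uncurry insertZero) (splits τ)  ≡⟨ ∑-cong-∈ (splits τ) (cong 𝟙 ∘ inTarget-insertion k {τ}) ⟩
    ∑ (𝟙 ∘ targetAfter k t o ∘ proj₂) (splits τ)        ≡⟨ ∑-splits _ τ ⟩
    ∑ (𝟙 ∘ targetAfter k t o) (tails τ)                  ≡⟨ ∑-tails-targetAfter k≤2 t o τ! ⟩
    𝟙 (target k t (suc o) ∧ endsWithDescent τ) + 2 * 𝟙 (inTarget k τ)  ∎
    where
    open ≡-Reasoning
    t = occurrences p123 τ
    o = occurrences p132 τ

  ∑-insertions-inTarget-descent : ∀ {τ} → Unique τ → τ ≢ [] →
    ∑ (λ xs → 𝟙 (inTarget k xs ∧ endsWithDescent xs)) (insertions τ)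
      ≡ 𝟙 (oneShortDescent k τ) + 𝟙 (inTarget k τ)
  ∑-insertions-inTarget-descent {[]}    _  []≢[] = contradiction refl []≢[]
  ∑-insertions-inTarget-descent {τ@(_ ∷ _)} τ! _ = begin
    ∑ (λ xs → 𝟙 (inTarget k xs ∧ endsWithDescent xs)) (insertions τ)
      ≡⟨ ∑-map _ (uncurry insertZero) (splits τ) ⟩
    ∑ (λ (α , β) → 𝟙 (inTarget k (insertZero α β) ∧ endsWithDescent (insertZero α β))) (splits τ)
      ≡⟨ ∑-cong-∈ (splits τ) pointwise ⟩
    ∑ ((λ β → 𝟙 (targetAfter k t o β ∧ descentAfterZero β)) ∘ proj₂) (splits τ)
      ≡⟨ ∑-splits _ τ ⟩
    ∑ (λ β → 𝟙 (targetAfter k t o β ∧ descentAfterZero β)) (tails τ)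
      ≡⟨ ∑-tails-targetAfter-descent k≤2 t o τ! ⟩
    𝟙 (target k t (suc o) ∧ endsWithDescent τ) + 𝟙 (inTarget k τ)  ∎
    where
    open ≡-Reasoning
    t = occurrences p123 τ
    o = occurrences p132 τ
    pointwise : ∀ {αβ} → αβ ∈ splits τ →
      𝟙 (inTarget k (uncurry insertZero αβ) ∧ endsWithDescent (uncurry insertZero αβ))
        ≡ 𝟙 (targetAfter k t o (proj₂ αβ) ∧ descentAfterZero (proj₂ αβ))
    pointwise {α , β} αβ∈ = cong 𝟙 (cong₂ _∧_ (inTarget-insertion k {τ} αβ∈)
      (endsWithDescent-insertZero α β λ α++β≡[] → contradiction (trans (sym (∈-splits⁻ {xs = τ} αβ∈)) α++β≡[]) λ ()))

-- The recurrences and their solution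

Nᵈ : ℕ → ℕ → ℕ
Nᵈ k n = ∑ (λ τ → 𝟙 (inTarget k τ ∧ endsWithDescent τ)) (permutations n)

Nᵈ₋₁ : ℕ → ℕ → ℕ
Nᵈ₋₁ k n = ∑ (𝟙 ∘ oneShortDescent k) (permutations n)

Nᵈ₋₁-zero : ∀ n → Nᵈ₋₁ 0 n ≡ 0
Nᵈ₋₁-zero n = ∑-zero (λ τ → cong (λ b → 𝟙 (b ∧ endsWithDescent τ)) (∧-zeroʳ _)) (permutations n)

Nᵈ₋₁-suc : ∀ k n → Nᵈ₋₁ (suc k) n ≡ Nᵈ k n
Nᵈ₋₁-suc k n = refl

∑-permutations-suc : ∀ n (f g : List ℕ → ℕ) →
  (∀ {τ} → Unique τ → τ ≢ [] → ∑ f (insertions τ) ≡ g τ) →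
  ∑ f (permutations (2 + n)) ≡ ∑ g (permutations (1 + n))
∑-permutations-suc n f g per-τ = trans (∑-concatMap f insertions (permutations (suc n)))
  (∑-cong-∈ (permutations (suc n)) λ τ∈ →
    let τ-perm = ∈-permutations⁻ (suc n) τ∈ in per-τ (proj₁ τ-perm) (IsPermℕ-nonempty τ-perm))

module _ {k} (k≤2 : k ≤ 2) (n : ℕ) where

  N-suc : N k (2 + n) ≡ Nᵈ₋₁ k (1 + n) + 2 * N k (1 + n)
  N-suc = begin
    N k (2 + n)
      ≡⟨ ∑-permutations-suc n _ _ (∑-insertions-inTarget k≤2) ⟩
    ∑ (λ τ → 𝟙 (oneShortDescent k τ) + 2 * 𝟙 (inTarget k τ)) (permutations (1 + n))
      ≡⟨ ∑-+ _ _ (permutations (1 + n)) ⟩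
    Nᵈ₋₁ k (1 + n) + ∑ (λ τ → 2 * 𝟙 (inTarget k τ)) (permutations (1 + n))
      ≡⟨ cong (Nᵈ₋₁ k (1 + n) +_) (∑-* 2 _ (permutations (1 + n))) ⟩
    Nᵈ₋₁ k (1 + n) + 2 * N k (1 + n)  ∎
    where open ≡-Reasoning

  Nᵈ-suc : Nᵈ k (2 + n) ≡ Nᵈ₋₁ k (1 + n) + N k (1 + n)
  Nᵈ-suc = trans (∑-permutations-suc n _ _ (∑-insertions-inTarget-descent k≤2)) (∑-+ _ _ (permutations (1 + n)))

N-0 : ∀ m → N 0 (1 + m) ≡ 2 ^ m
N-0 zero    = refl
N-0 (suc m) = begin
  N 0 (2 + m)                      ≡⟨ N-suc z≤n m ⟩
  Nᵈ₋₁ 0 (1 + m) + 2 * N 0 (1 + m)  ≡⟨ cong₂ _+_ (Nᵈ₋₁-zero (1 + m)) (cong (2 *_) (N-0 m)) ⟩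
  2 ^ suc m                        ∎
  where open ≡-Reasoning

Nᵈ-0 : ∀ m → Nᵈ 0 (2 + m) ≡ 2 ^ m
Nᵈ-0 m = begin
  Nᵈ 0 (2 + m)                  ≡⟨ Nᵈ-suc z≤n m ⟩
  Nᵈ₋₁ 0 (1 + m) + N 0 (1 + m)  ≡⟨ cong₂ _+_ (Nᵈ₋₁-zero (1 + m)) (N-0 m) ⟩
  2 ^ m                         ∎
  where open ≡-Reasoning

N-1 : ∀ m → N 1 (3 + m) ≡ (1 + m) * 2 ^ m
N-1 zero    = refl
N-1 (suc m) = begin
  N 1 (4 + m)                        ≡⟨ N-suc (s≤s z≤n) (2 + m) ⟩
  Nᵈ₋₁ 1 (3 + m) + 2 * N 1 (3 + m)   ≡⟨ cong₂ (λ a b → a + 2 * b) (trans (Nᵈ₋₁-suc 0 (3 + m)) (Nᵈ-0 (1 + m))) (N-1 m) ⟩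
  2 ^ suc m + 2 * ((1 + m) * 2 ^ m)  ≡⟨ solve 2 (λ m p → con 2 :* p :+ con 2 :* ((con 1 :+ m) :* p)
                                                    := (con 2 :+ m) :* (con 2 :* p)) refl m (2 ^ m) ⟩
  (2 + m) * 2 ^ suc m                ∎
  where open ≡-Reasoning

Nᵈ-1 : ∀ m → Nᵈ 1 (4 + m) ≡ (3 + m) * 2 ^ m
Nᵈ-1 m = begin
  Nᵈ 1 (4 + m)                  ≡⟨ Nᵈ-suc (s≤s z≤n) (2 + m) ⟩
  Nᵈ₋₁ 1 (3 + m) + N 1 (3 + m)  ≡⟨ cong₂ _+_ (trans (Nᵈ₋₁-suc 0 (3 + m)) (Nᵈ-0 (1 + m))) (N-1 m) ⟩
  2 ^ suc m + (1 + m) * 2 ^ m   ≡⟨ solve 2 (λ m p → con 2 :* p :+ (con 1 :+ m) :* p := (con 3 :+ m) :* p) refl m (2 ^ m) ⟩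
  (3 + m) * 2 ^ m               ∎
  where open ≡-Reasoning

N-2 : ∀ m → N 2 (5 + m) ≡ (2 + m) * 2 ^ suc m + ((2 + m) C 2) * 2 ^ m
N-2 zero    = refl
N-2 (suc m) = begin
  N 2 (6 + m)
    ≡⟨ N-suc ≤-refl (4 + m) ⟩
  Nᵈ₋₁ 2 (5 + m) + 2 * N 2 (5 + m)
    ≡⟨ cong₂ (λ a b → a + 2 * b) (trans (Nᵈ₋₁-suc 1 (5 + m)) (Nᵈ-1 (1 + m))) (N-2 m) ⟩
  (4 + m) * 2 ^ suc m + 2 * ((2 + m) * 2 ^ suc m + ((2 + m) C 2) * 2 ^ m)
    ≡⟨ solve 3 (λ m c p → (con 4 :+ m) :* (con 2 :* p) :+ con 2 :* ((con 2 :+ m) :* (con 2 :* p) :+ c :* p)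
                       := (con 3 :+ m) :* (con 2 :* (con 2 :* p)) :+ ((con 2 :+ m) :+ c) :* (con 2 :* p))
               refl m ((2 + m) C 2) (2 ^ m) ⟩
  (3 + m) * 2 ^ suc (suc m) + ((2 + m) + (2 + m) C 2) * 2 ^ suc m
    ≡⟨ cong (λ c → (3 + m) * 2 ^ suc (suc m) + c * 2 ^ suc m) pascal ⟩
  (3 + m) * 2 ^ suc (suc m) + ((3 + m) C 2) * 2 ^ suc m  ∎
  where
  open ≡-Reasoning
  pascal : (2 + m) + (2 + m) C 2 ≡ (3 + m) C 2
  pascal = trans (cong (_+ (2 + m) C 2) (sym (nC1≡n (2 + m)))) (nCk+nC[k+1]≡[n+1]C[k+1] (2 + m) 1)

mainTheorem3 : (n : ℕ) → 3 ≤ n →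
    count n ≡ ((n ∸ 3) C 1) * 2 ^ (n ∸ 4) + ((n ∸ 3) C 2) * 2 ^ (n ∸ 5)
mainTheorem3 0 ()
mainTheorem3 1 (s≤s ())
mainTheorem3 2 (s≤s (s≤s ()))
mainTheorem3 3 _ = count≡N 3
mainTheorem3 4 _ = count≡N 4
mainTheorem3 (suc (suc (suc (suc (suc m))))) _ = begin
  count (5 + m)                                      ≡⟨ count≡N (5 + m) ⟩
  N 2 (5 + m)                                        ≡⟨ N-2 m ⟩
  (2 + m) * 2 ^ suc m + ((2 + m) C 2) * 2 ^ m        ≡⟨ cong (λ c → c * 2 ^ suc m + ((2 + m) C 2) * 2 ^ m) (nC1≡n (2 + m)) ⟨
  ((2 + m) C 1) * 2 ^ suc m + ((2 + m) C 2) * 2 ^ m  ∎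
  where open ≡-Reasoning
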